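{- Let $n\ge0$ and $m\ge2$ be integers, and let $x=\lfloor (n+\phi^2)/\phi\rfloor F_m+nF_{m+1}$. Then $\mathrm{sh}_F(x)=\lfloor (n+\phi^2)/\phi\rfloor F_{m+1}+nF_{m+2}$.
   Context: $F_i$ are the Fibonacci numbers ($F_0=0,F_1=1,F_{m+1}=F_m+F_{m-1}$), $\phi=(1+\sqrt5)/2$. Every positive integer $x$ has a unique Zeckendorf representation $x=\sum_{i\in S}F_i$ with all indices $i\ge2$ and no two consecutive; the Zeckendorf shift is $\mathrm{sh}_F(x)=\sum_{i\in S}F_{i+1}$, with $\mathrm{sh}_F(0)=0$. -}

module Defs where

open import Data.Nat using (ℕ; zero; suc; _+_; _*_; _∸_; _≤_; _<_)
open import Data.List using (List; []; _∷_; map)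
open import Data.Nat.ListAction using (sum)
open import Data.Product using (_×_)

fib : ℕ → ℕ
fib zero = 0
fib (suc zero) = 1
fib (suc (suc m)) = fib (suc m) + fib m

data Zeck : List ℕ → Set where
  zeck-nil  : Zeck []
  zeck-one  : ∀ {i} → 2 ≤ i → Zeck (i ∷ [])
  zeck-cons : ∀ {i j S} → 2 + j ≤ i → Zeck (j ∷ S) → Zeck (i ∷ j ∷ S)

zval : List ℕ → ℕ
zval S = sum (map fib S)

zshift : List ℕ → ℕ
zshift S = sum (map (λ i → fib (suc i)) S)

-- a = ⌊(n + φ²)/φ⌋.  Since φ² = φ + 1 and 1/φ = φ - 1,
-- (n + φ²)/φ = (n+1)φ - n = (n+1)(1+√5)/2 - n, so
--   a ≤ (n+φ²)/φ < a+1  ⟺  2a+n-1 ≤ (n+1)√5 < 2a+n+1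
--                       ⟺  (2a+n-1)² ≤ 5(n+1)² < (2a+n+1)²
-- (the left side 2a+n-1 is ≥ -1; when it is -1 the truncated value 0 keeps the
-- inequality true, so truncated subtraction is harmless).
IsFloorNPhiSqOverPhi : ℕ → ℕ → Set
IsFloorNPhiSqOverPhi n a =
  ((2 * a + n ∸ 1) * (2 * a + n ∸ 1) ≤ 5 * ((n + 1) * (n + 1)))
  × (5 * ((n + 1) * (n + 1)) < (2 * a + n + 1) * (2 * a + n + 1))

-- With ψ = −1/φ one has F (i + 1) − φ F i = ψ^i, so sh_F(x) − φ x = Σ_{i∈S} ψ^i, and for a
-- Zeckendorf set S this lies in (−1/φ², 1/φ), an interval of length 1.  For
-- y = a F (m + 1) + n F (m + 2) one gets y − φ x = ψ^m (a − n/φ); the floor condition puts a − n/φ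
-- in (1/φ, φ), so for m ≥ 2 this lies in the same interval, and y = sh_F(x).
-- Without reals, φ is approximated by F (k + 3) / F (k + 2) for large k.  The defects
-- y F (k + 2) − x F (k + 3) of both candidates lie in [1 − F k, F (k + 1) − 1], which is shorter
-- than F (k + 2), the step between the defects of consecutive y; d'Ocagne's identity computes the
-- defects exactly.  The bounds (a + n)/(n + 1) < φ < (a + n + 1)/(n + 1) carry over to
-- F (t + 1) / F t for large t by Euclid's algorithm on the continued fraction [1; 1, 1, …] of φ.
module Submission where

open import Defs

module FibonacciRatio where
  open import Data.Nat
  open import Data.Nat.Properties
  open import Data.Nat.Tactic.RingSolver using (solve-∀)
  open import Data.Nat.Induction using (<-wellFounded)
  open import Data.Product using (∃-syntax; _×_; _,_)
  open import Data.Sum using (inj₁; inj₂)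
  open import Induction.WellFounded using (Acc; acc)
  open import Relation.Binary.PropositionalEquality
  open import Relation.Nullary using (contradiction)

  private variable
    m n p q : ℕ
    P Q : ℕ → Set

  Eventually : (ℕ → Set) → Set
  Eventually P = ∃[ T ] (∀ t → T ≤ t → P t)

  eventually-map : (∀ t → P t → Q t) → Eventually P → Eventually Q
  eventually-map f (T , p) = T , λ t T≤t → f t (p t T≤t)

  eventually-pred : Eventually (λ t → P (suc t)) → Eventually P
  eventually-pred (T , p) = suc T , λ { (suc t) (s≤s T≤t) → p t T≤t }

  eventually-+ : ∀ c → Eventually P → Eventually (λ t → P (c + t))
  eventually-+ c (T , p) = T , λ t T≤t → p (c + t) (≤-trans T≤t (m≤n+m t c))

  eventually-× : Eventually P → Eventually Q → Eventually (λ t → P t × Q t)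
  eventually-× (T , p) (U , q) = T + U , λ t T+U≤t →
    p t (≤-trans (m≤m+n T U) T+U≤t) , q t (≤-trans (m≤n+m U T) T+U≤t)

  eventually⇒∃ : Eventually P → ∃[ t ] P t
  eventually⇒∃ (T , p) = T , p T ≤-refl

  fib-pos : ∀ n → 0 < fib (suc n)
  fib-pos zero    = s≤s z≤n
  fib-pos (suc n) = ≤-trans (fib-pos n) (m≤m+n _ _)

  fib-≤-suc : ∀ n → fib n ≤ fib (suc n)
  fib-≤-suc zero    = z≤n
  fib-≤-suc (suc n) = m≤m+n _ _

  fib-mono : m ≤ n → fib m ≤ fib n
  fib-mono {m} m≤n = go (≤⇒≤′ m≤n)
    where
    go : ∀ {n} → m ≤′ n → fib m ≤ fib n
    go ≤′-refl         = ≤-refl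
    go (≤′-step {n} p) = ≤-trans (go p) (fib-≤-suc n)

  -- For q > 0 these say p / q ≤ φ and φ ≤ p / q, as φ is the positive root of x² = x + 1.
  _/_≤φ : ℕ → ℕ → Set
  p / q ≤φ = p * p ≤ p * q + q * q

  φ≤_/_ : ℕ → ℕ → Set
  φ≤ p / q = p * q + q * q ≤ p * p

  private
    square-+ : ∀ q r → (q + r) * (q + r) ≡ (q * r + r * r) + (q * q + q * r)
    square-+ = solve-∀

    golden-+ : ∀ q r → (q + r) * q + q * q ≡ q * q + (q * q + q * r)
    golden-+ = solve-∀

  -- (q + r) / q = 1 + r / q and φ = 1 + 1 / φ: one step of the continued fraction of φ.
  ≤φ-euclid : ∀ q r → (q + r) / q ≤φ → φ≤ q / r
  ≤φ-euclid q r h = +-cancelʳ-≤ (q * q + q * r) _ _ (subst₂ _≤_ (square-+ q r) (golden-+ q r) h)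

  φ≤-euclid : ∀ q r → φ≤ (q + r) / q → q / r ≤φ
  φ≤-euclid q r h = +-cancelʳ-≤ (q * q + q * r) _ _ (subst₂ _≤_ (golden-+ q r) (square-+ q r) h)

  mutual
    ≤φ⇒below-fib-ratio : Acc _<_ p → 0 < q → p / q ≤φ →
                         Eventually (λ t → p * fib t < q * fib (suc t))
    ≤φ⇒below-fib-ratio {p} {q} (acc rec) 0<q p/q≤φ with ≤-<-connex p q
    ... | inj₁ p≤q = 2 , below
      where
      below : ∀ t → 2 ≤ t → p * fib t < q * fib (suc t)
      below (suc zero)    (s≤s ())
      below (suc (suc t)) _ = begin-strict
        p * fib (2 + t)                   ≤⟨ *-monoˡ-≤ _ p≤q ⟩
        q * fib (2 + t)                   <⟨ m<m+n _ (*-mono-≤ 0<q (fib-pos t)) ⟩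
        q * fib (2 + t) + q * fib (1 + t) ≡⟨ *-distribˡ-+ q _ _ ⟨
        q * fib (3 + t)                   ∎
        where open ≤-Reasoning
    ... | inj₂ q<p with m≤n⇒∃[o]m+o≡n (<⇒≤ q<p)
    ...   | r , refl = eventually-pred (eventually-map step
                         (φ≤⇒above-fib-ratio (rec q<p) 0<q (≤φ-euclid q r p/q≤φ)))
      where
      step : ∀ t → r * fib (suc t) < q * fib t → (q + r) * fib (suc t) < q * fib (2 + t)
      step t h = begin-strict
        (q + r) * fib (suc t)             ≡⟨ *-distribʳ-+ _ q r ⟩
        q * fib (suc t) + r * fib (suc t) <⟨ +-monoʳ-< _ h ⟩
        q * fib (suc t) + q * fib t       ≡⟨ *-distribˡ-+ q _ _ ⟨
        q * fib (2 + t)                   ∎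
        where open ≤-Reasoning

    φ≤⇒above-fib-ratio : Acc _<_ p → 0 < p → φ≤ p / q →
                         Eventually (λ t → q * fib (suc t) < p * fib t)
    φ≤⇒above-fib-ratio {p} {q} (acc rec) 0<p φ≤p/q with ≤-<-connex p q
    ... | inj₁ p≤q = contradiction φ≤p/q (<⇒≱ (begin-strict
        p * p         ≤⟨ *-monoʳ-≤ p p≤q ⟩
        p * q         <⟨ m<m+n _ (*-mono-≤ 0<q 0<q) ⟩
        p * q + q * q ∎))
      where
      open ≤-Reasoning
      0<q : 0 < q
      0<q = ≤-trans 0<p p≤q
    ... | inj₂ q<p with m≤n⇒∃[o]m+o≡n (<⇒≤ q<p)
    ...   | r , refl = eventually-pred (eventually-map step
                         (≤φ⇒below-fib-ratio (rec q<p) 0<r (φ≤-euclid q r φ≤p/q)))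
      where
      0<r : 0 < r
      0<r = +-cancelˡ-< q 0 r (subst (_< q + r) (sym (+-identityʳ q)) q<p)
      step : ∀ t → q * fib t < r * fib (suc t) → q * fib (2 + t) < (q + r) * fib (suc t)
      step t h = begin-strict
        q * fib (2 + t)                   ≡⟨ *-distribˡ-+ q _ _ ⟩
        q * fib (suc t) + q * fib t       <⟨ +-monoʳ-< _ h ⟩
        q * fib (suc t) + r * fib (suc t) ≡⟨ *-distribʳ-+ _ q r ⟨
        (q + r) * fib (suc t)             ∎
        where open ≤-Reasoning

  -- 4 (p² − pq − q²) = (2p − q)² − 5q², the integral form of 2φ − 1 = √5.
  golden-discriminant : ∀ s p q → s + q ≡ 2 * p →
                        4 * (p * p) + 5 * (q * q) ≡ s * s + 4 * (p * q + q * q)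
  golden-discriminant s p q s+q≡2p = begin
    4 * (p * p) + 5 * (q * q)               ≡⟨ double-square p q ⟩
    (2 * p) * (2 * p) + 5 * (q * q)         ≡⟨ cong (λ x → x * x + 5 * (q * q)) s+q≡2p ⟨
    (s + q) * (s + q) + 5 * (q * q)         ≡⟨ expand s q ⟩
    s * s + (2 * q * (s + q) + 4 * (q * q)) ≡⟨ cong (λ x → s * s + (2 * q * x + 4 * (q * q))) s+q≡2p ⟩
    s * s + (2 * q * (2 * p) + 4 * (q * q)) ≡⟨ collect s p q ⟩
    s * s + 4 * (p * q + q * q)             ∎
    where
    open ≡-Reasoning
    double-square : ∀ p q → 4 * (p * p) + 5 * (q * q) ≡ (2 * p) * (2 * p) + 5 * (q * q)
    double-square = solve-∀
    expand : ∀ s q → (s + q) * (s + q) + 5 * (q * q) ≡ s * s + (2 * q * (s + q) + 4 * (q * q))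
    expand = solve-∀
    collect : ∀ s p q → s * s + (2 * q * (2 * p) + 4 * (q * q)) ≡ s * s + 4 * (p * q + q * q)
    collect = solve-∀

  ≤φ-from-discriminant : ∀ s p q → s + q ≡ 2 * p → s * s ≤ 5 * (q * q) → p / q ≤φ
  ≤φ-from-discriminant s p q s+q≡2p h = *-cancelˡ-≤ 4 (+-cancelʳ-≤ (5 * (q * q)) _ _ (begin
    4 * (p * p) + 5 * (q * q)         ≡⟨ golden-discriminant s p q s+q≡2p ⟩
    s * s + 4 * (p * q + q * q)       ≤⟨ +-monoˡ-≤ _ h ⟩
    5 * (q * q) + 4 * (p * q + q * q) ≡⟨ +-comm (5 * (q * q)) _ ⟩
    4 * (p * q + q * q) + 5 * (q * q) ∎))
    where open ≤-Reasoning

  φ≤-from-discriminant : ∀ s p q → s + q ≡ 2 * p → 5 * (q * q) ≤ s * s → φ≤ p / q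
  φ≤-from-discriminant s p q s+q≡2p h = *-cancelˡ-≤ 4 (+-cancelʳ-≤ (5 * (q * q)) _ _ (begin
    4 * (p * q + q * q) + 5 * (q * q) ≡⟨ +-comm _ (5 * (q * q)) ⟩
    5 * (q * q) + 4 * (p * q + q * q) ≤⟨ +-monoˡ-≤ _ h ⟩
    s * s + 4 * (p * q + q * q)       ≡⟨ golden-discriminant s p q s+q≡2p ⟨
    4 * (p * p) + 5 * (q * q)         ∎))
    where open ≤-Reasoning

  floor-lower-sum : ∀ a n → 1 ≤ 2 * a + n → (2 * a + n ∸ 1) + (n + 1) ≡ 2 * (a + n)
  floor-lower-sum a n 1≤2a+n = begin
    (2 * a + n ∸ 1) + (n + 1) ≡⟨ move-one (2 * a + n ∸ 1) n ⟩
    (2 * a + n ∸ 1) + 1 + n   ≡⟨ cong (_+ n) (m∸n+n≡m 1≤2a+n) ⟩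
    2 * a + n + n             ≡⟨ regroup a n ⟩
    2 * (a + n)               ∎
    where
    open ≡-Reasoning
    move-one : ∀ y n → y + (n + 1) ≡ y + 1 + n
    move-one = solve-∀
    regroup : ∀ a n → 2 * a + n + n ≡ 2 * (a + n)
    regroup = solve-∀

  floor-upper-sum : ∀ a n → (2 * a + n + 1) + (n + 1) ≡ 2 * (a + n + 1)
  floor-upper-sum = solve-∀

  floor⇒≤φ : ∀ n a → (2 * a + n ∸ 1) * (2 * a + n ∸ 1) ≤ 5 * ((n + 1) * (n + 1)) →
             (a + n) / (n + 1) ≤φ
  floor⇒≤φ zero    zero    _ = z≤n
  floor⇒≤φ (suc n) zero    = ≤φ-from-discriminant (2 * 0 + suc n ∸ 1) (0 + suc n) (suc n + 1)
                               (floor-lower-sum 0 (suc n) (s≤s z≤n))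
  floor⇒≤φ n       (suc a) = ≤φ-from-discriminant (2 * suc a + n ∸ 1) (suc a + n) (n + 1)
                               (floor-lower-sum (suc a) n (s≤s z≤n))

  floor⇒φ≤ : ∀ n a → 5 * ((n + 1) * (n + 1)) < (2 * a + n + 1) * (2 * a + n + 1) →
             φ≤ (a + n + 1) / (n + 1)
  floor⇒φ≤ n a h =
    φ≤-from-discriminant (2 * a + n + 1) (a + n + 1) (n + 1) (floor-upper-sum a n) (<⇒≤ h)

  FibRatioBetween : ℕ → ℕ → ℕ → ℕ → Set
  FibRatioBetween p r q t = p * fib t < q * fib (suc t) × q * fib (suc t) < r * fib t

  floor⇒fib-ratio-between : ∀ n a → IsFloorNPhiSqOverPhi n a →
                            Eventually (FibRatioBetween (a + n) (a + n + 1) (n + 1))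
  floor⇒fib-ratio-between n a (lower , upper) = eventually-×
    (≤φ⇒below-fib-ratio (<-wellFounded (a + n)) (m≤n+m 1 n) (floor⇒≤φ n a lower))
    (φ≤⇒above-fib-ratio (<-wellFounded (a + n + 1)) (m≤n+m 1 (a + n)) (floor⇒φ≤ n a upper))

module FibonacciDefect where
  open import Data.Integer hiding (suc)
  open import Data.Integer.Properties hiding (suc-mono)
  open import Data.Integer.Tactic.RingSolver using (solve-∀)
  open import Data.Nat as ℕ using (ℕ; zero; suc; s≤s; z≤n)
  import Data.Nat.Properties as ℕ
  open import Data.Nat.Tactic.RingSolver renaming (solve-∀ to ℕ-solve-∀)
  open import Data.Empty using (⊥; ⊥-elim)
  open import Data.List using (List; []; _∷_)
  open import Data.Product using (_×_; _,_; proj₁; proj₂)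
  open import Relation.Binary.Definitions using (tri<; tri≈; tri>)
  open import Relation.Binary.PropositionalEquality
  open FibonacciRatio using (Eventually; FibRatioBetween; fib-pos; fib-mono)

  private variable
    d e i k o x y y′ : ℕ
    M D v : ℤ

  fibℤ : ℕ → ℤ
  fibℤ k = + fib k

  fibℤ-mono : i ℕ.≤ k → fibℤ i ≤ fibℤ k
  fibℤ-mono i≤k = +≤+ (fib-mono i≤k)

  fib-det : ℕ → ℕ → ℤ
  fib-det i k = fibℤ (suc i) * fibℤ k - fibℤ i * fibℤ (suc k)

  fib-det-suc : ∀ i k → fib-det (suc i) (suc k) ≡ - fib-det i k
  fib-det-suc i k = shift (fibℤ (suc i)) (fibℤ i) (fibℤ (suc k)) (fibℤ k)
    where
    shift : ∀ A B C D → (A + B) * C - A * (C + D) ≡ - (A * D - B * C)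
    shift = solve-∀

  d'Ocagne : ∀ i e → fib-det i (i ℕ.+ e) ≡ -1ℤ ^ i * fibℤ e
  d'Ocagne zero    e = base (fibℤ e) (fibℤ (suc e))
    where
    base : ∀ X Y → 1ℤ * X - 0ℤ * Y ≡ 1ℤ * X
    base = solve-∀
  d'Ocagne (suc i) e = begin
    fib-det (suc i) (suc (i ℕ.+ e)) ≡⟨ fib-det-suc i (i ℕ.+ e) ⟩
    - fib-det i (i ℕ.+ e)           ≡⟨ cong -_ (d'Ocagne i e) ⟩
    - (-1ℤ ^ i * fibℤ e)            ≡⟨ negate (-1ℤ ^ i) (fibℤ e) ⟩
    -1ℤ ^ suc i * fibℤ e            ∎
    where
    open ≡-Reasoning
    negate : ∀ s X → - (s * X) ≡ (-1ℤ * s) * X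
    negate = solve-∀

  infix 4 ∣_∣≤_
  record ∣_∣≤_ (v M : ℤ) : Set where
    constructor _,_
    field
      lower : - M ≤ v
      upper : v ≤ M

  ∣-∣≤ : ∣ v ∣≤ M → ∣ - v ∣≤ M
  ∣-∣≤ {v} {M} (-M≤v , v≤M) =
    neg-mono-≤ v≤M , subst (- v ≤_) (neg-involutive M) (neg-mono-≤ -M≤v)

  ∣-1^*∣≤ : ∀ i → ∣ v ∣≤ M → ∣ -1ℤ ^ i * v ∣≤ M
  ∣-1^*∣≤ {v} {M} zero    h = subst (λ w → ∣ w ∣≤ M) (sym (*-identityˡ v)) h
  ∣-1^*∣≤ {v} {M} (suc i) h = subst (λ w → ∣ w ∣≤ M) (sym negate) (∣-∣≤ (∣-1^*∣≤ i h))
    where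
    negate : -1ℤ * -1ℤ ^ i * v ≡ - (-1ℤ ^ i * v)
    negate = trans (*-assoc -1ℤ (-1ℤ ^ i) v) (-1*i≡-i _)

  fib-det-bound : i ℕ.+ o ≡ k → ∣ fib-det i (2 ℕ.+ k) ∣≤ fibℤ (2 ℕ.+ o)
  fib-det-bound {i} {o} refl =
    subst (λ K → ∣ fib-det i K ∣≤ fibℤ (2 ℕ.+ o)) reindex
      (subst (λ w → ∣ w ∣≤ fibℤ (2 ℕ.+ o)) (sym (d'Ocagne i (2 ℕ.+ o)))
        (∣-1^*∣≤ i (neg-≤-pos , ≤-refl)))
    where
    reindex : i ℕ.+ (2 ℕ.+ o) ≡ 2 ℕ.+ (i ℕ.+ o)
    reindex = trans (ℕ.+-suc i (suc o)) (cong suc (ℕ.+-suc i o))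

  -- Equals F (k + 2) (y − φ x) − x ψ^(k + 2), with ψ = −1/φ.
  defect : ℕ → ℕ → ℕ → ℤ
  defect x y k = + y * fibℤ (2 ℕ.+ k) - + x * fibℤ (3 ℕ.+ k)

  defect-+ : ∀ x y x′ y′ k → defect (x ℕ.+ x′) (y ℕ.+ y′) k ≡ defect x y k + defect x′ y′ k
  defect-+ x y x′ y′ k = split (+ y) (+ y′) (+ x) (+ x′) (fibℤ (2 ℕ.+ k)) (fibℤ (3 ℕ.+ k))
    where
    split : ∀ Y Y′ X X′ K L → (Y + Y′) * K - (X + X′) * L ≡ (Y * K - X * L) + (Y′ * K - X′ * L)
    split = solve-∀

  defect-* : ∀ c x y k → defect (c ℕ.* x) (c ℕ.* y) k ≡ + c * defect x y k
  defect-* c x y k = begin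
    + (c ℕ.* y) * K - + (c ℕ.* x) * L ≡⟨ cong₂ (λ u w → u * K - w * L) (pos-* c y) (pos-* c x) ⟩
    + c * + y * K - + c * + x * L     ≡⟨ factor (+ c) (+ y) (+ x) K L ⟩
    + c * defect x y k                ∎
    where
    open ≡-Reasoning
    K L : ℤ
    K = fibℤ (2 ℕ.+ k)
    L = fibℤ (3 ℕ.+ k)
    factor : ∀ C Y X K L → C * Y * K - C * X * L ≡ C * (Y * K - X * L)
    factor = solve-∀

  defect-+ʳ : ∀ x y t k → defect x (y ℕ.+ t) k ≡ defect x y k + + t * fibℤ (2 ℕ.+ k)
  defect-+ʳ x y t k = shift (+ y) (+ t) (+ x) (fibℤ (2 ℕ.+ k)) (fibℤ (3 ℕ.+ k))
    where
    shift : ∀ Y T X K L → (Y + T) * K - X * L ≡ (Y * K - X * L) + T * K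
    shift = solve-∀

  zdefect : List ℕ → ℕ → ℤ
  zdefect S k = defect (zval S) (zshift S) k

  zdefect-∷ : ∀ i S k → zdefect (i ∷ S) k ≡ fib-det i (2 ℕ.+ k) + zdefect S k
  zdefect-∷ i S k = defect-+ (fib i) (fib (suc i)) (zval S) (zshift S) k

  record Window (d k : ℕ) (v : ℤ) : Set where
    constructor _,_
    field
      lower : fibℤ d - fibℤ k ≤ v
      upper : v ≤ fibℤ (suc k) - fibℤ d

  window-zero : d ℕ.≤ k → Window d k 0ℤ
  window-zero d≤k = i≤j⇒i-j≤0 (fibℤ-mono d≤k) , i≤j⇒0≤j-i (fibℤ-mono (ℕ.m≤n⇒m≤1+n d≤k))

  window-weaken : d ℕ.≤ e → Window e k v → Window d k v
  window-weaken {d} {e} {k} d≤e (lo , hi) =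
    ≤-trans (+-monoˡ-≤ (- fibℤ k) (fibℤ-mono d≤e)) lo ,
    ≤-trans hi (+-monoʳ-≤ (fibℤ (suc k)) (neg-mono-≤ (fibℤ-mono d≤e)))

  window-cons : ∣ D ∣≤ fibℤ (suc d) → Window (2 ℕ.+ d) k v → Window d k (D + v)
  window-cons {D} {d} {k} {v} (-F≤D , D≤F) (lo , hi) =
    (begin
      fibℤ d - fibℤ k                            ≡⟨ lower (fibℤ (suc d)) (fibℤ d) (fibℤ k) ⟩
      - fibℤ (suc d) + (fibℤ (2 ℕ.+ d) - fibℤ k) ≤⟨ +-mono-≤ -F≤D lo ⟩
      D + v                                      ∎) ,
    (begin
      D + v                                      ≤⟨ +-mono-≤ D≤F hi ⟩
      fibℤ (suc d) + (U - fibℤ (2 ℕ.+ d))        ≡⟨ upper (fibℤ (suc d)) (fibℤ d) U ⟩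
      U - fibℤ d                                 ∎)
    where
    open ≤-Reasoning
    lower : ∀ A B L → B - L ≡ - A + ((A + B) - L)
    lower = solve-∀
    upper : ∀ A B U → A + (U - (A + B)) ≡ U - B
    upper = solve-∀
    U : ℤ
    U = fibℤ (suc k)

  window-∷ : ∀ i S → i ℕ.+ o ≡ k → Window (3 ℕ.+ o) k (zdefect S k) →
             Window (suc o) k (zdefect (i ∷ S) k)
  window-∷ {o} {k} i S i+o≡k w =
    subst (Window (suc o) k) (sym (zdefect-∷ i S k)) (window-cons (fib-det-bound {i} {o} i+o≡k) w)

  zeck-window : ∀ {i S} → Zeck (i ∷ S) → i ℕ.+ o ≡ k → Window (suc o) k (zdefect (i ∷ S) k)
  zeck-window (zeck-one {zero} ())
  zeck-window (zeck-one {suc zero} (s≤s ()))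
  -- The sign (−1)² = 1 matters here: a negative term −F (o + 2) would not fit in the window.
  zeck-window {o} (zeck-one {suc (suc zero)} _) refl =
    subst (Window (suc o) (2 ℕ.+ o)) (sym single)
      (lower , ≤-reflexive (cancel (fibℤ (2 ℕ.+ o)) (fibℤ (suc o))))
    where
    single : zdefect (2 ∷ []) (2 ℕ.+ o) ≡ fibℤ (2 ℕ.+ o)
    single = begin
      zdefect (2 ∷ []) (2 ℕ.+ o)       ≡⟨ zdefect-∷ 2 [] (2 ℕ.+ o) ⟩
      fib-det 2 (2 ℕ.+ (2 ℕ.+ o)) + 0ℤ ≡⟨ +-identityʳ _ ⟩
      fib-det 2 (2 ℕ.+ (2 ℕ.+ o))      ≡⟨ d'Ocagne 2 (2 ℕ.+ o) ⟩
      1ℤ * fibℤ (2 ℕ.+ o)              ≡⟨ *-identityˡ _ ⟩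
      fibℤ (2 ℕ.+ o)                   ∎
      where open ≡-Reasoning
    lower : fibℤ (suc o) - fibℤ (2 ℕ.+ o) ≤ fibℤ (2 ℕ.+ o)
    lower = ≤-trans (i≤j⇒i-j≤0 (fibℤ-mono (ℕ.n≤1+n (suc o)))) (+≤+ z≤n)
    cancel : ∀ A B → A ≡ (A + B) - B
    cancel = solve-∀
  zeck-window {o} (zeck-one {suc (suc (suc i))} _) refl =
    window-∷ (3 ℕ.+ i) [] refl (window-zero (s≤s (s≤s (s≤s (ℕ.m≤n+m o i)))))
  zeck-window {o} (zeck-cons {i} {j} {S} j+2≤i z) refl with ℕ.m≤n⇒∃[o]m+o≡n j+2≤i
  ... | g , refl =
    window-∷ (2 ℕ.+ j ℕ.+ g) (j ∷ S) refl
      (window-weaken (s≤s (s≤s (s≤s (ℕ.m≤n+m o g)))) (zeck-window z (reassoc j g o)))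
    where
    reassoc : ∀ j g o → j ℕ.+ (2 ℕ.+ (g ℕ.+ o)) ≡ 2 ℕ.+ j ℕ.+ g ℕ.+ o
    reassoc = ℕ-solve-∀

  zeck-window-eventually : ∀ {S} → Zeck S → Eventually (λ k → Window 1 k (zdefect S k))
  zeck-window-eventually zeck-nil = 1 , λ k 1≤k → window-zero 1≤k
  zeck-window-eventually {i ∷ S} z =
    i , λ k i≤k → window-weaken (s≤s z≤n) (zeck-window {k ℕ.∸ i} z (ℕ.m+[n∸m]≡n i≤k))

  cofactor : ℕ → ℕ → ℕ → ℤ
  cofactor a n e = + a * fibℤ (suc e) - + n * fibℤ e

  candidate-defect : ∀ a n m′ e →
    defect (a ℕ.* fib (2 ℕ.+ m′) ℕ.+ n ℕ.* fib (3 ℕ.+ m′))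
           (a ℕ.* fib (3 ℕ.+ m′) ℕ.+ n ℕ.* fib (4 ℕ.+ m′)) (suc m′ ℕ.+ e)
    ≡ -1ℤ ^ m′ * cofactor a n e
  candidate-defect a n m′ e = begin
    defect (a ℕ.* fib m ℕ.+ n ℕ.* fib (suc m)) (a ℕ.* fib (suc m) ℕ.+ n ℕ.* fib (2 ℕ.+ m)) K
      ≡⟨ defect-+ (a ℕ.* fib m) (a ℕ.* fib (suc m)) (n ℕ.* fib (suc m)) (n ℕ.* fib (2 ℕ.+ m)) K ⟩
    defect (a ℕ.* fib m) (a ℕ.* fib (suc m)) K + defect (n ℕ.* fib (suc m)) (n ℕ.* fib (2 ℕ.+ m)) K
      ≡⟨ cong₂ _+_ (defect-* a (fib m) (fib (suc m)) K) (defect-* n (fib (suc m)) (fib (2 ℕ.+ m)) K) ⟩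
    + a * fib-det m (2 ℕ.+ K) + + n * fib-det (suc m) (2 ℕ.+ K)
      ≡⟨ cong₂ (λ u w → + a * u + + n * w) d'Ocagne-m (d'Ocagne (suc m) e) ⟩
    + a * (-1ℤ ^ m * fibℤ (suc e)) + + n * (-1ℤ ^ suc m * fibℤ e)
      ≡⟨ collect (+ a) (+ n) (-1ℤ ^ m′) (fibℤ (suc e)) (fibℤ e) ⟩
    -1ℤ ^ m′ * cofactor a n e
      ∎
    where
    open ≡-Reasoning
    m K : ℕ
    m = 2 ℕ.+ m′
    K = suc m′ ℕ.+ e
    d'Ocagne-m : fib-det m (2 ℕ.+ K) ≡ -1ℤ ^ m * fibℤ (suc e)
    d'Ocagne-m = trans (cong (λ j → fib-det m (2 ℕ.+ j)) (sym (ℕ.+-suc m′ e))) (d'Ocagne m (suc e))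
    collect : ∀ A N s F₁ F₀ →
              A * (-1ℤ * (-1ℤ * s) * F₁) + N * (-1ℤ * (-1ℤ * (-1ℤ * s)) * F₀) ≡ s * (A * F₁ - N * F₀)
    collect = solve-∀

  pos-*-< : ∀ p x q y → p ℕ.* x ℕ.< q ℕ.* y → 1ℤ + + p * + x ≤ + q * + y
  pos-*-< p x q y h = subst₂ _≤_ (cong (λ z → 1ℤ + z) (pos-* p x)) (pos-* q y) (+≤+ h)

  cofactor-bounds : ∀ a n e → FibRatioBetween (a ℕ.+ n) (a ℕ.+ n ℕ.+ 1) (n ℕ.+ 1) (suc e) →
                    0ℤ ≤ cofactor a n e × cofactor a n e ≤ fibℤ (2 ℕ.+ e) - 1ℤ
  cofactor-bounds a n e (below , above) =
    (begin
      0ℤ                              ≤⟨ +≤+ z≤n ⟩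
      1ℤ + F₀                         ≡⟨ lower-left N F₁ F₀ ⟩
      (1ℤ + (N + 1ℤ) * (F₁ + F₀)) - C ≤⟨ +-monoˡ-≤ (- C) aboveℤ ⟩
      (A + N + 1ℤ) * F₁ - C           ≡⟨ lower-right A N F₁ F₀ ⟩
      cofactor a n e                  ∎) ,
    (begin
      cofactor a n e                  ≡⟨ upper-left A N F₁ F₀ ⟩
      (1ℤ + (A + N) * F₁) - C′        ≤⟨ +-monoˡ-≤ (- C′) belowℤ ⟩
      (N + 1ℤ) * (F₁ + F₀) - C′       ≡⟨ upper-right N F₁ F₀ ⟩
      (F₁ + F₀) - 1ℤ                  ∎)
    where
    open ≤-Reasoning
    A N F₁ F₀ C C′ : ℤ
    A = + a
    N = + n
    F₁ = fibℤ (suc e)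
    F₀ = fibℤ e
    C = (N + 1ℤ) * (F₁ + F₀) - F₀
    C′ = N * (F₁ + F₀) + 1ℤ
    belowℤ : 1ℤ + (A + N) * F₁ ≤ (N + 1ℤ) * (F₁ + F₀)
    belowℤ = pos-*-< (a ℕ.+ n) (fib (suc e)) (n ℕ.+ 1) (fib (2 ℕ.+ e)) below
    aboveℤ : 1ℤ + (N + 1ℤ) * (F₁ + F₀) ≤ (A + N + 1ℤ) * F₁
    aboveℤ = pos-*-< (n ℕ.+ 1) (fib (2 ℕ.+ e)) (a ℕ.+ n ℕ.+ 1) (fib (suc e)) above
    lower-left : ∀ N F₁ F₀ →
                 1ℤ + F₀ ≡ (1ℤ + (N + 1ℤ) * (F₁ + F₀)) - ((N + 1ℤ) * (F₁ + F₀) - F₀)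
    lower-left = solve-∀
    lower-right : ∀ A N F₁ F₀ →
                  (A + N + 1ℤ) * F₁ - ((N + 1ℤ) * (F₁ + F₀) - F₀) ≡ A * F₁ - N * F₀
    lower-right = solve-∀
    upper-left : ∀ A N F₁ F₀ →
                 A * F₁ - N * F₀ ≡ (1ℤ + (A + N) * F₁) - (N * (F₁ + F₀) + 1ℤ)
    upper-left = solve-∀
    upper-right : ∀ N F₁ F₀ →
                  (N + 1ℤ) * (F₁ + F₀) - (N * (F₁ + F₀) + 1ℤ) ≡ (F₁ + F₀) - 1ℤ
    upper-right = solve-∀

  ∣∣≤⇒window : i ℕ.≤ k → ∣ v ∣≤ fibℤ i - 1ℤ → Window 1 k v
  ∣∣≤⇒window {i} {k} {v} i≤k (lo , hi) =
    (begin
      1ℤ - fibℤ k       ≤⟨ +-monoʳ-≤ 1ℤ (neg-mono-≤ (fibℤ-mono i≤k)) ⟩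
      1ℤ - fibℤ i       ≡⟨ flip (fibℤ i) ⟩
      - (fibℤ i - 1ℤ)   ≤⟨ lo ⟩
      v                 ∎) ,
    (begin
      v                 ≤⟨ hi ⟩
      fibℤ i - 1ℤ       ≤⟨ +-monoˡ-≤ -1ℤ (fibℤ-mono (ℕ.m≤n⇒m≤1+n i≤k)) ⟩
      fibℤ (suc k) - 1ℤ ∎)
    where
    open ≤-Reasoning
    flip : ∀ X → 1ℤ - X ≡ - (X - 1ℤ)
    flip = solve-∀

  candidate-window : ∀ a n e m′ → FibRatioBetween (a ℕ.+ n) (a ℕ.+ n ℕ.+ 1) (n ℕ.+ 1) (suc e) →
    Window 1 (suc m′ ℕ.+ e)
      (defect (a ℕ.* fib (2 ℕ.+ m′) ℕ.+ n ℕ.* fib (3 ℕ.+ m′))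
              (a ℕ.* fib (3 ℕ.+ m′) ℕ.+ n ℕ.* fib (4 ℕ.+ m′)) (suc m′ ℕ.+ e))
  candidate-window a n e m′ ratios =
    subst (Window 1 (suc m′ ℕ.+ e)) (sym (candidate-defect a n m′ e)) (signed m′)
    where
    W : ℤ
    W = cofactor a n e
    0≤W : 0ℤ ≤ W
    0≤W = proj₁ (cofactor-bounds a n e ratios)
    W≤F-1 : W ≤ fibℤ (2 ℕ.+ e) - 1ℤ
    W≤F-1 = proj₂ (cofactor-bounds a n e ratios)
    -- For m = 2 the window is only wide enough because the sign is positive.
    signed : ∀ m′ → Window 1 (suc m′ ℕ.+ e) (-1ℤ ^ m′ * W)
    signed zero     = subst (Window 1 (suc e)) (sym (*-identityˡ W))
      (≤-trans (i≤j⇒i-j≤0 (+≤+ (fib-pos e))) 0≤W , W≤F-1)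
    signed (suc m″) = ∣∣≤⇒window (s≤s (s≤s (ℕ.m≤n+m e m″))) (∣-1^*∣≤ (suc m″)
      (≤-trans (neg-mono-≤ (i≤j⇒0≤j-i (+≤+ (fib-pos (suc e))))) 0≤W , W≤F-1))

  defect-window-< : y ℕ.< y′ → Window 1 k (defect x y k) → Window 1 k (defect x y′ k) → ⊥
  defect-window-< {y} {y′} {k} {x} y<y′ (lo , _) (_ , hi) with ℕ.m≤n⇒∃[o]m+o≡n y<y′
  ... | t , refl = <-irrefl refl (≤-<-trans too-far (+-monoʳ-< (fibℤ (suc k)) -<+))
    where
    open ≤-Reasoning
    gap : fibℤ (2 ℕ.+ k) ≤ + suc t * fibℤ (2 ℕ.+ k)
    gap = subst (_ ≤_) (pos-* (suc t) (fib (2 ℕ.+ k))) (+≤+ (ℕ.m≤m+n _ _))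
    regroup : ∀ F₁ F₀ → F₁ + 1ℤ ≡ (1ℤ - F₀) + (F₁ + F₀)
    regroup = solve-∀
    too-far : fibℤ (suc k) + 1ℤ ≤ fibℤ (suc k) - 1ℤ
    too-far = begin
      fibℤ (suc k) + 1ℤ                       ≡⟨ regroup (fibℤ (suc k)) (fibℤ k) ⟩
      (1ℤ - fibℤ k) + fibℤ (2 ℕ.+ k)          ≤⟨ +-mono-≤ lo gap ⟩
      defect x y k + + suc t * fibℤ (2 ℕ.+ k) ≡⟨ defect-+ʳ x y (suc t) k ⟨
      defect x (y ℕ.+ suc t) k                ≡⟨ cong (λ z → defect x z k) (ℕ.+-suc y t) ⟩
      defect x (suc y ℕ.+ t) k                ≤⟨ hi ⟩
      fibℤ (suc k) - 1ℤ                       ∎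

  defect-window-unique : ∀ x → Window 1 k (defect x y k) → Window 1 k (defect x y′ k) → y ≡ y′
  defect-window-unique {k} {y} {y′} x w w′ with ℕ.<-cmp y y′
  ... | tri< y<y′ _ _ = ⊥-elim (defect-window-< {k = k} {x} y<y′ w w′)
  ... | tri≈ _ y≡y′ _ = y≡y′
  ... | tri> _ _ y′<y = ⊥-elim (defect-window-< {k = k} {x} y′<y w′ w)

open import Data.Nat using (ℕ; suc; _+_; _*_; _≤_; s≤s)
open import Data.List using (List)
open import Data.Product using (_,_)
open import Relation.Binary.PropositionalEquality using (_≡_; subst)
open FibonacciRatio using (eventually⇒∃; eventually-×; eventually-+; floor⇒fib-ratio-between)
open FibonacciDefect using (Window; defect; zeck-window-eventually; candidate-window; defect-window-unique)

lemma5 : (n m a : ℕ) → 2 ≤ m → IsFloorNPhiSqOverPhi n a →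
    (S : List ℕ) → Zeck S → zval S ≡ a * fib m + n * fib (suc m) →
    zshift S ≡ a * fib (suc m) + n * fib (suc (suc m))
lemma5 n (suc (suc m′)) a (s≤s (s≤s _)) floor S zeck zval≡ =
  let e , S-window , ratios =
        eventually⇒∃ (eventually-× (eventually-+ (suc m′) (zeck-window-eventually zeck))
                                   (eventually-+ 1 (floor⇒fib-ratio-between n a floor)))
  in defect-window-unique (a * fib (2 + m′) + n * fib (3 + m′))
       (subst (λ x → Window 1 (suc m′ + e) (defect x (zshift S) (suc m′ + e))) zval≡ S-window)
       (candidate-window a n e m′ ratios)
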